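{- Let $m\ge2$ be an integer. Every element of $\mathbb{Q}_m$ can be represented in the form $\sum_{k=0}^\infty \left(\frac{m}{m+1}\right)^k s_k$ (a series convergent in $\mathbb{Q}_m$) for a unique sequence $\{s_k\}_{k\ge0}$ with each $s_k\in\{0,1,\dots,m-1\}$.
   Context: $D_m$ is the set of rational numbers $a/b$ with $a,b$ relatively prime integers and $b$ relatively prime to $m$; it is a subring of $\mathbb{Q}$ (and contains $\frac{m}{m+1}$). For such $a/b$ with $a\neq0$, $|a/b|_m=m^{ -k}$, where $k$ is the greatest integer such that $m^k$ divides $a$; $|0|_m=0$; and $d(u,v)=|u-v|_m$ is a metric on $D_m$ making it a topological ring. $\mathbb{Q}_m$ is the Cauchy completion of $(D_m,d)$, with ring operations and metric extended by continuity. -}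

module Defs where

open import Data.Nat using (ℕ; zero; suc; _≥_; _^_)
open import Data.Nat.Coprimality using (Coprime)
open import Data.Integer using (ℤ; +_)
open import Data.Integer.Divisibility using (_∣_)
open import Data.Rational using (ℚ; _/_; _+_; _*_; _-_; 0ℚ; 1ℚ; ↥_; ↧ₙ_)
open import Data.Fin using (Fin; toℕ)
open import Data.Product using (Σ; ∃; ∃-syntax; _×_)

InD : ℕ → ℚ → Set
InD m q = Coprime (↧ₙ q) m

-- "d(u,v) ≤ m^{-n}" for u, v in D_m, where d(u,v) = |u - v|_m.
-- Writing u - v = a/b in lowest terms, |a/b|_m = m^{-K} with K maximal such
-- that m^K ∣ a (and |0|_m = 0), so |a/b|_m ≤ m^{-n} iff m^n ∣ a.
DistLe : ℕ → ℚ → ℚ → ℕ → Set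
DistLe m u v n = (+ (m ^ n)) ∣ (↥ (u - v))

-- Cauchy sequences in (D_m, d)  (ε ranges over m^{-n}, which is cofinal).
record CauchySeq (m : ℕ) : Set where
  field
    seq     : ℕ → ℚ
    inD     : ∀ k → InD m (seq k)
    cauchy  : ∀ n → ∃[ N ] (∀ p q → p ≥ N → q ≥ N → DistLe m (seq p) (seq q) n)
open CauchySeq public

-- Q_m = Cauchy completion: elements are Cauchy sequences (up to equivalence).
-- Extended metric: d(x,y) = lim_q d(x_q, y_q); since the values lie in
-- {0} ∪ {m^{-k}}, d(x,y) ≤ m^{-n} iff eventually d(x_q, y_q) ≤ m^{-n}.
DistLeQ : (m : ℕ) → CauchySeq m → CauchySeq m → ℕ → Set
DistLeQ m x y n = ∃[ Q ] (∀ q → q ≥ Q → DistLe m (seq x q) (seq y q) n)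

const : (m : ℕ) (u : ℚ) → InD m u → CauchySeq m
const m u h = record
  { seq = λ _ → u ; inD = λ _ → h
  ; cauchy = λ n → 0 , λ p q _ _ → self n }
  where
  open import Data.Product using (_,_)
  open import Relation.Binary.PropositionalEquality using (_≡_; subst; sym; cong)
  import Data.Nat.Divisibility as ND
  import Data.Rational.Properties as QP
  import Data.Integer as Z
  self : ∀ n → DistLe m u u n
  self n = subst (λ z → (m ^ n) ND.∣ Z.∣ z ∣) (sym (cong ↥_ (QP.+-inverseʳ u))) (ND._∣0 (m ^ n))

ratio : ℕ → ℚ
ratio m = (+ m) / suc m

powQ : ℚ → ℕ → ℚ
powQ r zero    = 1ℚ
powQ r (suc k) = powQ r k * r

partialSum : (m : ℕ) → (ℕ → Fin m) → ℕ → ℚ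
partialSum m s zero    = 0ℚ
partialSum m s (suc N) = partialSum m s N + powQ (ratio m) N * ((+ toℕ (s N)) / 1)

-- Each partial sum lies in D_m (denominator a power of m+1, coprime to m);
-- it is viewed in Q_m via the constant-sequence embedding, so
-- d(S_p, x) ≤ m^{-n} is DistLeQ (const S_p) x n, unfolded below.
-- "the series Σ (m/(m+1))^k s_k converges in Q_m to x":
-- ∀ n ∃ N ∀ p ≥ N, d(S_p, x) ≤ m^{-n}, with d(S_p, x) = lim_q d(S_p, x_q).
SeriesConvergesTo : (m : ℕ) → (ℕ → Fin m) → CauchySeq m → Set
SeriesConvergesTo m s x =
  ∀ n → ∃[ N ] (∀ p → p ≥ N → ∃[ Q ] (∀ q → q ≥ Q → DistLe m (partialSum m s p) (seq x q) n))

{-# OPTIONS --safe #-}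
module Submission where

-- On unnormalised rationals, |q|ₘ ≤ m⁻ⁿ means q = a/b with b prime to m and mⁿ ∣ a, and u ≈[ n ] v
-- means |u − v|ₘ ≤ m⁻ⁿ; closure under + and − makes ≈[ n ] an equivalence (the metric is ultrametric).
-- Existence: for a/b ∈ Dₘ let c invert b modulo m and d = ac mod m. Then m ∣ a − db, so
-- a/b = d + (m/(m+1))·a′/b with a′/b ∈ Dₘ, and iterating gives a/b ≈[ n ] Sₙ for the digits produced.
-- The terms of a Cauchy sequence eventually share their first j+1 digits; these are the digits of x.
-- Uniqueness: r = m/(m+1) has norm exactly m⁻¹, so Sₙ(s) ≈[ n ] Sₙ(t) forces s and t to agree below n,
-- and the partial sums of two digit series converging to x are that close.

open import Defs
open import Data.Nat using (ℕ; _≤_)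
open import Data.Fin using (Fin)
open import Data.Product using (Σ; _×_)
open import Relation.Binary.PropositionalEquality using (_≡_)

open import Data.Product using (_,_; proj₁; proj₂)
open import Data.Sum using (_⊎_; inj₁; inj₂)
open import Data.List using (_∷_; [])
open import Function using (_∘_; _$_)
open import Relation.Nullary using (contradiction)
open import Relation.Binary.PropositionalEquality
  using (refl; sym; trans; cong; cong₂; subst; subst₂; module ≡-Reasoning)
open import Data.Fin using (toℕ; fromℕ<)
open import Data.Fin.Properties using (toℕ-fromℕ<; toℕ-injective; toℕ<n)
open import Data.Nat as ℕ using (zero; suc; _^_; _<_; _⊔_; NonZero)
import Data.Nat.Properties as ℕ
open import Data.Nat.Coprimality as Coprimality using (Coprime; 1-coprimeTo; coprime-divisor)
import Data.Nat.Divisibility as ℕ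
import Data.Nat.GCD as GCD
open import Data.Integer as ℤ using (ℤ; +_)
import Data.Integer.Properties as ℤ
import Data.Integer.DivMod as ℤ
import Data.Integer.Divisibility as ℤᵤ
open import Data.Integer.Divisibility.Signed as ℤ using (∣ᵤ⇒∣; ∣⇒∣ᵤ)
import Data.Rational as ℚ
import Data.Rational.Properties as ℚ
open import Data.Rational.Unnormalised using (ℚᵘ; mkℚᵘ; ↧ₙ_; _≃_; *≡*; 0ℚᵘ; 1ℚᵘ)
open import Data.Rational.Unnormalised.Properties
  using ( ≃-refl; ≃-sym; ≃-trans; ≃-reflexive; +-cong; +-congʳ; +-congˡ; *-cong; *-congˡ; *-congʳ
        ; -‿cong; +-inverseʳ; +-identityˡ; *-identityˡ)
open import Data.Rational.Unnormalised.Solver using (module +-*-Solver)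
open +-*-Solver using (solve; _:=_; _:+_; _:*_; _:-_; :-_)
open import Data.Integer.Tactic.RingSolver as ℤ-Solver using ()

coprime-* : ∀ {a b c} → Coprime a c → Coprime b c → Coprime (a ℕ.* b) c
coprime-* {a} {b} {c} a⊥c b⊥c {d} (d∣ab , d∣c) = b⊥c (coprime-divisor d⊥a d∣ab , d∣c)
  where
  d⊥a : Coprime d a
  d⊥a (e∣d , e∣a) = a⊥c (e∣a , ℕ.∣-trans e∣d d∣c)

coprime-^ : ∀ {a c} n → Coprime a c → Coprime (a ^ n) c
coprime-^ zero    _   = 1-coprimeTo _
coprime-^ (suc n) a⊥c = coprime-* a⊥c (coprime-^ n a⊥c)

∣-coprime : ∀ {d a c} → d ℕ.∣ a → Coprime a c → Coprime d c
∣-coprime d∣a a⊥c (e∣d , e∣c) = a⊥c (ℕ.∣-trans e∣d d∣a , e∣c)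

small-multiple≡0 : ∀ {m n} → m ℕ.∣ n → n < m → n ≡ 0
small-multiple≡0 {n = zero}  _   _   = refl
small-multiple≡0 {n = suc _} m∣n n<m = contradiction m∣n (ℕ.>⇒∤ n<m)

module _ where
  open import Data.Integer using (_+_; _*_; _-_; -_; 1ℤ)
  open ≡-Reasoning

  bézout-inverse : ∀ {b m} → Coprime b m → Σ ℤ λ c → Σ ℤ λ l → c * + b ≡ 1ℤ + l * + m
  bézout-inverse {b} {m} b⊥m with Coprimality.coprime-Bézout b⊥m
  ... | GCD.Bézout.+- x y 1+ym≡xb = + x , + y , xb≡1+ym
    where
    xb≡1+ym : + x * + b ≡ 1ℤ + + y * + m
    xb≡1+ym = begin
      + x * + b        ≡⟨ ℤ.pos-* x b ⟨
      + (x ℕ.* b)      ≡⟨ cong +_ 1+ym≡xb ⟨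
      1ℤ + + (y ℕ.* m) ≡⟨ cong (λ k → 1ℤ + k) (ℤ.pos-* y m) ⟩
      1ℤ + + y * + m   ∎
  ... | GCD.Bézout.-+ x y 1+xb≡ym = - + x , - + y , negate (+ x) (+ b) (+ y) (+ m) 1+xb≡ym′
    where
    1+xb≡ym′ : 1ℤ + + x * + b ≡ + y * + m
    1+xb≡ym′ = begin
      1ℤ + + x * + b   ≡⟨ cong (λ k → 1ℤ + k) (ℤ.pos-* x b) ⟨
      + (1 ℕ.+ x ℕ.* b) ≡⟨ cong +_ 1+xb≡ym ⟩
      + (y ℕ.* m)      ≡⟨ ℤ.pos-* y m ⟩
      + y * + m        ∎
    negate : ∀ x b y m → 1ℤ + x * b ≡ y * m → - x * b ≡ 1ℤ + - y * m
    negate x b y m 1+xb≡ym = begin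
      - x * b             ≡⟨ ℤ-Solver.solve (x ∷ b ∷ []) ⟩
      1ℤ - (1ℤ + x * b)   ≡⟨ cong (λ k → 1ℤ - k) 1+xb≡ym ⟩
      1ℤ - y * m          ≡⟨ ℤ-Solver.solve (y ∷ m ∷ []) ⟩
      1ℤ + - y * m        ∎

  carry-identity : ∀ a b c l m d q → c * b ≡ 1ℤ + l * m → a * c ≡ d + q * m →
                   a - d * b ≡ (q * b - a * l) * m
  carry-identity a b c l m d q cb≡1+lm ac≡d+qm = begin
    a - d * b                                          ≡⟨ ℤ-Solver.solve (a ∷ b ∷ l ∷ m ∷ d ∷ q ∷ []) ⟩
    a * (1ℤ + l * m) - (d + q * m) * b + (q * b - a * l) * m
      ≡⟨ cong₂ (λ x y → a * x - y * b + (q * b - a * l) * m) cb≡1+lm ac≡d+qm ⟨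
    a * (c * b) - (a * c) * b + (q * b - a * l) * m     ≡⟨ ℤ-Solver.solve (a ∷ b ∷ c ∷ l ∷ m ∷ q ∷ []) ⟩
    (q * b - a * l) * m                                ∎

  cross-multiplied-step : ∀ a d e b m → a - d * b ≡ e * m →
                          a * (1ℤ * ((1ℤ + m) * b)) ≡ (d * ((1ℤ + m) * b) + m * (e * (1ℤ + m)) * 1ℤ) * b
  cross-multiplied-step a d e b m a-db≡em = begin
    a * (1ℤ * ((1ℤ + m) * b))                        ≡⟨ ℤ-Solver.solve (a ∷ d ∷ b ∷ m ∷ []) ⟩
    ((a - d * b) + d * b) * ((1ℤ + m) * b)           ≡⟨ cong (λ x → (x + d * b) * ((1ℤ + m) * b)) a-db≡em ⟩
    (e * m + d * b) * ((1ℤ + m) * b)                 ≡⟨ ℤ-Solver.solve (d ∷ e ∷ b ∷ m ∷ []) ⟩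
    (d * ((1ℤ + m) * b) + m * (e * (1ℤ + m)) * 1ℤ) * b ∎

module _ (m : ℕ) where

  open import Data.Rational.Unnormalised using (_+_; _*_; -_; _-_)

  CoprimeDen : ℚᵘ → Set
  CoprimeDen q = Coprime (↧ₙ q) m

  coprimeDen-+ : ∀ p q → CoprimeDen p → CoprimeDen q → CoprimeDen (p + q)
  coprimeDen-+ (mkℚᵘ _ _) (mkℚᵘ _ _) = coprime-*

  coprimeDen-* : ∀ p q → CoprimeDen p → CoprimeDen q → CoprimeDen (p * q)
  coprimeDen-* (mkℚᵘ _ _) (mkℚᵘ _ _) = coprime-*

  coprimeDen-sub : ∀ p q → CoprimeDen p → CoprimeDen q → CoprimeDen (p - q)
  coprimeDen-sub p (mkℚᵘ _ _) = coprimeDen-+ p _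

  record NormLe (q : ℚᵘ) (n : ℕ) : Set where
    constructor normLe
    field
      num     : ℤ
      den-1   : ℕ
      den⊥m   : Coprime (suc den-1) m
      m^n∣num : + (m ^ n) ℤ.∣ num
      q≃      : q ≃ mkℚᵘ num den-1

  NormLe-cong : ∀ {p q n} → p ≃ q → NormLe p n → NormLe q n
  NormLe-cong p≃q (normLe a b b⊥m m^n∣a p≃) = normLe a b b⊥m m^n∣a (≃-trans (≃-sym p≃q) p≃)

  NormLe-0 : ∀ {n} → NormLe 0ℚᵘ n
  NormLe-0 = normLe (+ 0) 0 (1-coprimeTo m) (ℤ.divides (+ 0) refl) ≃-refl

  NormLe-fraction : ∀ a b → Coprime (suc b) m → NormLe (mkℚᵘ a b) 0
  NormLe-fraction a b b⊥m = normLe a b b⊥m (ℤ.divides a (sym (ℤ.*-identityʳ a))) ≃-refl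

  NormLe-+ : ∀ {p q n} → NormLe p n → NormLe q n → NormLe (p + q) n
  NormLe-+ (normLe a b b⊥m m^n∣a p≃) (normLe a′ b′ b′⊥m m^n∣a′ q≃) =
    normLe (a ℤ.* + suc b′ ℤ.+ a′ ℤ.* + suc b) (b′ ℕ.+ b ℕ.* suc b′) (coprime-* b⊥m b′⊥m)
      (ℤ.∣m∣n⇒∣m+n (ℤ.∣m⇒∣m*n _ m^n∣a) (ℤ.∣m⇒∣m*n _ m^n∣a′)) (+-cong p≃ q≃)

  NormLe-neg : ∀ {q n} → NormLe q n → NormLe (- q) n
  NormLe-neg (normLe a b b⊥m m^n∣a q≃) = normLe (ℤ.- a) b b⊥m (ℤ.∣m⇒∣-m m^n∣a) (-‿cong q≃)

  NormLe-* : ∀ {p q i j} → NormLe p i → NormLe q j → NormLe (p * q) (i ℕ.+ j)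
  NormLe-* {i = i} {j} (normLe a b b⊥m m^i∣a p≃) (normLe a′ b′ b′⊥m m^j∣a′ q≃) =
    normLe (a ℤ.* a′) (b′ ℕ.+ b ℕ.* suc b′) (coprime-* b⊥m b′⊥m) m^[i+j]∣aa′ (*-cong p≃ q≃)
    where
    m^[i+j]≡ : + (m ^ (i ℕ.+ j)) ≡ + (m ^ i) ℤ.* + (m ^ j)
    m^[i+j]≡ = trans (cong +_ (ℕ.^-distribˡ-+-* m i j)) (ℤ.pos-* (m ^ i) (m ^ j))
    m^[i+j]∣aa′ : + (m ^ (i ℕ.+ j)) ℤ.∣ a ℤ.* a′
    m^[i+j]∣aa′ = subst (ℤ._∣ a ℤ.* a′) (sym m^[i+j]≡)
      (ℤ.∣-trans (ℤ.*-monoˡ-∣ (+ (m ^ j)) m^i∣a) (ℤ.*-monoʳ-∣ a m^j∣a′))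

  NormLe-weaken : ∀ {q i j} → i ≤ j → NormLe q j → NormLe q i
  NormLe-weaken {i = i} {j} i≤j (normLe a b b⊥m m^j∣a q≃) =
    normLe a b b⊥m (ℤ.∣-trans (∣ᵤ⇒∣ m^i∣m^j) m^j∣a) q≃
    where
    m^i∣m^j : m ^ i ℕ.∣ m ^ j
    m^i∣m^j = subst (λ k → m ^ i ℕ.∣ m ^ k) (ℕ.m+[n∸m]≡n i≤j)
      (subst (m ^ i ℕ.∣_) (sym (ℕ.^-distribˡ-+-* m i (j ℕ.∸ i))) (ℕ.m∣m*n _))

  NormLe⇒m^n∣numerator : ∀ {a b n} → NormLe (mkℚᵘ a b) n → + (m ^ n) ℤ.∣ a
  NormLe⇒m^n∣numerator {a} {b} {n} (normLe a′ b′ b′⊥m m^n∣a′ (*≡* ab′≡a′b)) =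
    ∣ᵤ⇒∣ (coprime-divisor (coprime-^ n (Coprimality.sym b′⊥m)) m^n∣b′a)
    where
    m^n∣b′a : m ^ n ℕ.∣ suc b′ ℕ.* ℤ.∣ a ∣
    m^n∣b′a = subst (m ^ n ℕ.∣_)
      (trans (sym (ℤ.abs-* a′ (+ suc b)))
        (trans (cong ℤ.∣_∣ (sym ab′≡a′b)) (trans (ℤ.abs-* a (+ suc b′)) (ℕ.*-comm ℤ.∣ a ∣ (suc b′)))))
      (ℕ.∣m⇒∣m*n (suc b) (∣⇒∣ᵤ m^n∣a′))

  infix 4 _≈[_]_
  record _≈[_]_ (p : ℚᵘ) (n : ℕ) (q : ℚᵘ) : Set where
    constructor mk≈
    field NormLe-diff : NormLe (p - q) n
  open _≈[_]_

  ≈-refl : ∀ {p n} → p ≈[ n ] p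
  ≈-refl {p} = mk≈ (NormLe-cong (≃-sym (+-inverseʳ p)) NormLe-0)

  ≈-sym : ∀ {p q n} → p ≈[ n ] q → q ≈[ n ] p
  ≈-sym {p} {q} (mk≈ p-q) = mk≈ (NormLe-cong (negate-diff p q) (NormLe-neg p-q))
    where
    negate-diff : ∀ p q → - (p - q) ≃ q - p
    negate-diff = solve 2 (λ p q → :- (p :- q) := q :- p) ≃-refl

  ≈-trans : ∀ {p q r n} → p ≈[ n ] q → q ≈[ n ] r → p ≈[ n ] r
  ≈-trans {p} {q} {r} (mk≈ p-q) (mk≈ q-r) = mk≈ (NormLe-cong (telescope p q r) (NormLe-+ p-q q-r))
    where
    telescope : ∀ p q r → (p - q) + (q - r) ≃ p - r
    telescope = solve 3 (λ p q r → (p :- q) :+ (q :- r) := p :- r) ≃-refl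

  ≈-weaken : ∀ {p q i j} → i ≤ j → p ≈[ j ] q → p ≈[ i ] q
  ≈-weaken i≤j (mk≈ p-q) = mk≈ (NormLe-weaken i≤j p-q)

  ≃+⇒≈ : ∀ {p q y n} → p ≃ q + y → NormLe y n → p ≈[ n ] q
  ≃+⇒≈ {p} {q} {y} p≃q+y y-small =
    mk≈ (NormLe-cong (≃-trans (≃-sym (cancel q y)) (+-congˡ (- q) (≃-sym p≃q+y))) y-small)
    where
    cancel : ∀ q y → (q + y) - q ≃ y
    cancel = solve 2 (λ q y → (q :+ y) :- q := y) ≃-refl

  InD⇒CoprimeDen : ∀ u → InD m u → CoprimeDen (ℚ.toℚᵘ u)
  InD⇒CoprimeDen (ℚ.mkℚ _ _ _) u∈D = u∈D

  ≃-CoprimeDen⇒InD : ∀ {P} w → ℚ.toℚᵘ w ≃ P → CoprimeDen P → InD m w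
  ≃-CoprimeDen⇒InD {mkℚᵘ a b} (ℚ.mkℚ n d n⊥d) (*≡* nb≡ad) b⊥m = ∣-coprime d∣b b⊥m
    where
    d∣nb : suc d ℕ.∣ ℤ.∣ n ∣ ℕ.* suc b
    d∣nb = subst (suc d ℕ.∣_) (trans (sym (ℤ.abs-* a (+ suc d))) (trans (cong ℤ.∣_∣ (sym nb≡ad)) (ℤ.abs-* n (+ suc b))))
      (ℕ.n∣m*n ℤ.∣ a ∣)
    d∣b : suc d ℕ.∣ suc b
    d∣b = coprime-divisor (Coprimality.sym (Coprimality.recompute n⊥d)) d∣nb

  toℚᵘ-sub≃ : ∀ {u v P Q} → ℚ.toℚᵘ u ≃ P → ℚ.toℚᵘ v ≃ Q → ℚ.toℚᵘ (u ℚ.- v) ≃ P - Q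
  toℚᵘ-sub≃ {u} {v} u≃P v≃Q =
    ≃-trans (ℚ.toℚᵘ-homo-+ u (ℚ.- v)) (+-cong u≃P (≃-trans (ℚ.toℚᵘ-homo‿- v) (-‿cong v≃Q)))

  ∣↥⇒NormLe : ∀ {n} w → InD m w → + (m ^ n) ℤᵤ.∣ ℚ.↥ w → NormLe (ℚ.toℚᵘ w) n
  ∣↥⇒NormLe (ℚ.mkℚ a b _) b⊥m m^n∣a = normLe a b b⊥m (∣ᵤ⇒∣ m^n∣a) ≃-refl

  NormLe⇒∣↥ : ∀ {n} w → NormLe (ℚ.toℚᵘ w) n → + (m ^ n) ℤᵤ.∣ ℚ.↥ w
  NormLe⇒∣↥ (ℚ.mkℚ a b _) = ∣⇒∣ᵤ ∘ NormLe⇒m^n∣numerator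

  DistLe⇒≈ : ∀ {u v P Q n} → ℚ.toℚᵘ u ≃ P → ℚ.toℚᵘ v ≃ Q → CoprimeDen P → CoprimeDen Q →
             DistLe m u v n → P ≈[ n ] Q
  DistLe⇒≈ {u} {v} {P} {Q} u≃P v≃Q P⊥m Q⊥m m^n∣u-v = mk≈ $ NormLe-cong u-v≃P-Q
    (∣↥⇒NormLe (u ℚ.- v) (≃-CoprimeDen⇒InD (u ℚ.- v) u-v≃P-Q (coprimeDen-sub P Q P⊥m Q⊥m)) m^n∣u-v)
    where
    u-v≃P-Q : ℚ.toℚᵘ (u ℚ.- v) ≃ P - Q
    u-v≃P-Q = toℚᵘ-sub≃ u≃P v≃Q

  ≈⇒DistLe : ∀ {u v P Q n} → ℚ.toℚᵘ u ≃ P → ℚ.toℚᵘ v ≃ Q → P ≈[ n ] Q → DistLe m u v n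
  ≈⇒DistLe {u} {v} u≃P v≃Q (mk≈ P-Q) = NormLe⇒∣↥ (u ℚ.- v) (NormLe-cong (≃-sym (toℚᵘ-sub≃ u≃P v≃Q)) P-Q)

  ratioᵘ : ℚᵘ
  ratioᵘ = mkℚᵘ (+ m) m

  powᵘ : ℕ → ℚᵘ
  powᵘ zero    = 1ℚᵘ
  powᵘ (suc n) = powᵘ n * ratioᵘ

  digitᵘ : Fin m → ℚᵘ
  digitᵘ f = mkℚᵘ (+ toℕ f) 0

  partialSumᵘ : (ℕ → Fin m) → ℕ → ℚᵘ
  partialSumᵘ s zero    = 0ℚᵘ
  partialSumᵘ s (suc n) = partialSumᵘ s n + powᵘ n * digitᵘ (s n)

  toℚᵘ-powQ : ∀ n → ℚ.toℚᵘ (powQ (ratio m) n) ≃ powᵘ n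
  toℚᵘ-powQ zero    = ≃-refl
  toℚᵘ-powQ (suc n) = ≃-trans (ℚ.toℚᵘ-homo-* (powQ (ratio m) n) (ratio m))
    (*-cong (toℚᵘ-powQ n) (ℚ.toℚᵘ-fromℚᵘ ratioᵘ))

  toℚᵘ-partialSum : ∀ s n → ℚ.toℚᵘ (partialSum m s n) ≃ partialSumᵘ s n
  toℚᵘ-partialSum s zero    = ≃-refl
  toℚᵘ-partialSum s (suc n) = ≃-trans (ℚ.toℚᵘ-homo-+ (partialSum m s n) _)
    (+-cong (toℚᵘ-partialSum s n)
      (≃-trans (ℚ.toℚᵘ-homo-* (powQ (ratio m) n) _) (*-cong (toℚᵘ-powQ n) (ℚ.toℚᵘ-fromℚᵘ (digitᵘ (s n))))))

  suc⊥m : Coprime (suc m) m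
  suc⊥m = subst (λ k → Coprime k m) (ℕ.+-comm m 1) (Coprimality.coprime-+ (1-coprimeTo m))

  powᵘ-fraction : ∀ n → Σ ℕ λ b → Coprime (suc b) m × powᵘ n ≃ mkℚᵘ (+ (m ^ n)) b
  powᵘ-fraction zero    = 0 , 1-coprimeTo m , ≃-refl
  powᵘ-fraction (suc n) with powᵘ-fraction n
  ... | b , b⊥m , rⁿ≃ = m ℕ.+ b ℕ.* suc m , coprime-* b⊥m suc⊥m ,
    ≃-trans (*-cong rⁿ≃ ≃-refl)
      (≃-reflexive (cong (λ a → mkℚᵘ a _) (trans (sym (ℤ.pos-* (m ^ n) m)) (cong +_ (ℕ.*-comm (m ^ n) m)))))

  NormLe-powᵘ : ∀ n → NormLe (powᵘ n) n
  NormLe-powᵘ n with powᵘ-fraction n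
  ... | b , b⊥m , rⁿ≃ = normLe (+ (m ^ n)) b b⊥m ℤ.∣-refl rⁿ≃

  NormLe-term : ∀ n f → NormLe (powᵘ n * digitᵘ f) n
  NormLe-term n f = subst (NormLe (powᵘ n * digitᵘ f)) (ℕ.+-identityʳ n)
    (NormLe-* (NormLe-powᵘ n) (NormLe-fraction (+ toℕ f) 0 (1-coprimeTo m)))

  partialSumᵘ-suc-≈ : ∀ s n → partialSumᵘ s (suc n) ≈[ n ] partialSumᵘ s n
  partialSumᵘ-suc-≈ s n = ≃+⇒≈ ≃-refl (NormLe-term n (s n))

  partialSumᵘ-≈ : ∀ s {n p} → n ≤ p → partialSumᵘ s p ≈[ n ] partialSumᵘ s n
  partialSumᵘ-≈ s = go ∘ ℕ.≤⇒≤′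
    where
    go : ∀ {n p} → n ℕ.≤′ p → partialSumᵘ s p ≈[ n ] partialSumᵘ s n
    go ℕ.≤′-refl          = ≈-refl
    go (ℕ.≤′-step n≤′p) = ≈-trans (≈-weaken (ℕ.≤′⇒≤ n≤′p) (partialSumᵘ-suc-≈ s _)) (go n≤′p)

  CoprimeDen-powᵘ : ∀ n → CoprimeDen (powᵘ n)
  CoprimeDen-powᵘ zero    = 1-coprimeTo m
  CoprimeDen-powᵘ (suc n) = coprimeDen-* (powᵘ n) ratioᵘ (CoprimeDen-powᵘ n) suc⊥m

  CoprimeDen-partialSumᵘ : ∀ s n → CoprimeDen (partialSumᵘ s n)
  CoprimeDen-partialSumᵘ s zero    = 1-coprimeTo m
  CoprimeDen-partialSumᵘ s (suc n) = coprimeDen-+ (partialSumᵘ s n) _ (CoprimeDen-partialSumᵘ s n)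
    (coprimeDen-* (powᵘ n) (digitᵘ (s n)) (CoprimeDen-powᵘ n) (1-coprimeTo m))


  module _ .{{_ : NonZero m}} where

    module Digits (b : ℕ) (b⊥m : Coprime (suc b) m) where

      private
        c l : ℤ
        c = proj₁ (bézout-inverse b⊥m)
        l = proj₁ (proj₂ (bézout-inverse b⊥m))

      leadingDigit : ℤ → Fin m
      leadingDigit a = fromℕ< (ℤ.n%ℕd<d (a ℤ.* c) m)

      carry : ℤ → ℤ
      carry a = (a ℤ.* c ℤ./ℕ m) ℤ.* + suc b ℤ.- a ℤ.* l

      shift : ℤ → ℤ
      shift a = carry a ℤ.* + suc m

      leadingDigit-step : ∀ a → mkℚᵘ a b ≃ digitᵘ (leadingDigit a) + ratioᵘ * mkℚᵘ (shift a) b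
      leadingDigit-step a = *≡* (cross-multiplied-step a (+ toℕ (leadingDigit a)) (carry a) (+ suc b) (+ m) digit-carry)
        where
        d : ℕ
        d = toℕ (leadingDigit a)
        digit-carry : a ℤ.- + d ℤ.* + suc b ≡ carry a ℤ.* + m
        digit-carry = carry-identity a (+ suc b) c l (+ m) (+ d) (a ℤ.* c ℤ./ℕ m)
          (proj₂ (proj₂ (bézout-inverse b⊥m)))
          (trans (ℤ.a≡a%ℕn+[a/ℕn]*n (a ℤ.* c) m)
            (cong (λ k → + k ℤ.+ (a ℤ.* c ℤ./ℕ m) ℤ.* + m) (sym (toℕ-fromℕ< _))))

      numerators : ℤ → ℕ → ℤ
      numerators a zero    = a
      numerators a (suc j) = shift (numerators a j)

      digits : ℤ → ℕ → Fin m
      digits a j = leadingDigit (numerators a j)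

      expansion : ∀ a n → mkℚᵘ a b ≃ partialSumᵘ (digits a) n + powᵘ n * mkℚᵘ (numerators a n) b
      expansion a zero    = ≃-sym (≃-trans (+-identityˡ _) (*-identityˡ _))
      expansion a (suc n) = ≃-trans (expansion a n) (≃-trans
        (+-congʳ (partialSumᵘ (digits a) n) (*-congˡ {powᵘ n} (leadingDigit-step (numerators a n))))
        (reassociate (partialSumᵘ (digits a) n) (powᵘ n) ratioᵘ _ _))
        where
        reassociate : ∀ s p r d x → s + p * (d + r * x) ≃ (s + p * d) + (p * r) * x
        reassociate = solve 5 (λ s p r d x → s :+ p :* (d :+ r :* x) := (s :+ p :* d) :+ (p :* r) :* x) ≃-refl

      ≈-partialSumᵘ-digits : ∀ a n → mkℚᵘ a b ≈[ n ] partialSumᵘ (digits a) n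
      ≈-partialSumᵘ-digits a n = ≃+⇒≈ (expansion a n) (subst (NormLe _) (ℕ.+-identityʳ n)
        (NormLe-* (NormLe-powᵘ n) (NormLe-fraction (numerators a n) b b⊥m)))

    digit-≡ : ∀ (f g : Fin m) → m ℕ.∣ ℤ.∣ + toℕ f ℤ.- + toℕ g ∣ → f ≡ g
    digit-≡ f g m∣f-g = toℕ-injective (ℤ.+-injective (ℤ.i-j≡0⇒i≡j _ _ (ℤ.∣i∣≡0⇒i≡0 ∣f-g∣≡0)))
      where
      ∣f-g∣<m : ℤ.∣ + toℕ f ℤ.- + toℕ g ∣ < m
      ∣f-g∣<m = subst (_< m) (cong ℤ.∣_∣ (sym (ℤ.m-n≡m⊖n (toℕ f) (toℕ g))))
        (ℕ.≤-<-trans (ℤ.∣m⊝n∣≤m⊔n (toℕ f) (toℕ g)) (ℕ.⊔-pres-<m (toℕ<n f) (toℕ<n g)))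
      ∣f-g∣≡0 : ℤ.∣ + toℕ f ℤ.- + toℕ g ∣ ≡ 0
      ∣f-g∣≡0 = small-multiple≡0 m∣f-g ∣f-g∣<m

    NormLe-powᵘ-*⇒∣ : ∀ k n a b → NormLe (powᵘ n * mkℚᵘ a b) (k ℕ.+ n) → m ^ k ℕ.∣ ℤ.∣ a ∣
    NormLe-powᵘ-*⇒∣ k n a b rⁿa-small with powᵘ-fraction n
    ... | b′ , _ , rⁿ≃ = ℤᵤ.*-cancelʳ-∣ (+ (m ^ n)) {+ (m ^ k)} {a} {{ℕ.m^n≢0 m n}} m^k*m^n∣a*m^n
      where
      m^[k+n]∣m^n*a : + (m ^ (k ℕ.+ n)) ℤ.∣ + (m ^ n) ℤ.* a
      m^[k+n]∣m^n*a = NormLe⇒m^n∣numerator (NormLe-cong (*-congʳ {mkℚᵘ a b} rⁿ≃) rⁿa-small)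
      m^k*m^n∣a*m^n : + (m ^ k) ℤ.* + (m ^ n) ℤᵤ.∣ a ℤ.* + (m ^ n)
      m^k*m^n∣a*m^n = subst₂ ℤᵤ._∣_
        (trans (cong +_ (ℕ.^-distribˡ-+-* m k n)) (ℤ.pos-* (m ^ k) (m ^ n)))
        (ℤ.*-comm (+ (m ^ n)) a)
        (∣⇒∣ᵤ m^[k+n]∣m^n*a)

    partialSumᵘ-cong : ∀ s t n → (∀ j → j < n → s j ≡ t j) → partialSumᵘ s n ≡ partialSumᵘ t n
    partialSumᵘ-cong s t zero    _    = refl
    partialSumᵘ-cong s t (suc n) s≗t = cong₂ (λ S d → S + powᵘ n * digitᵘ d)
      (partialSumᵘ-cong s t n (λ j j<n → s≗t j (ℕ.m<n⇒m<1+n j<n))) (s≗t n (ℕ.n<1+n n))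

    last-digit-≡ : ∀ n f g → NormLe (powᵘ n * (digitᵘ f - digitᵘ g)) (suc n) → f ≡ g
    last-digit-≡ n f g small = digit-≡ f g (subst (ℕ._∣ ℤ.∣ + toℕ f ℤ.- + toℕ g ∣) (ℕ.*-identityʳ m)
      (NormLe-powᵘ-*⇒∣ 1 n (+ toℕ f ℤ.- + toℕ g) 0 (NormLe-cong (*-congˡ {powᵘ n} f-g≃) small)))
      where
      difference : ∀ x y → (x ℤ.* ℤ.1ℤ ℤ.+ ℤ.- y ℤ.* ℤ.1ℤ) ℤ.* ℤ.1ℤ ≡ (x ℤ.- y) ℤ.* ℤ.1ℤ
      difference = ℤ-Solver.solve-∀
      f-g≃ : digitᵘ f - digitᵘ g ≃ mkℚᵘ (+ toℕ f ℤ.- + toℕ g) 0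
      f-g≃ = *≡* (difference (+ toℕ f) (+ toℕ g))

    partialSumᵘ-injective : ∀ n s t → partialSumᵘ s n ≈[ n ] partialSumᵘ t n → ∀ j → j < n → s j ≡ t j
    partialSumᵘ-injective zero    s t _ j ()
    partialSumᵘ-injective (suc n) s t sₙ₊₁≈tₙ₊₁ j j<1+n = pick (ℕ.m≤n⇒m<n∨m≡n (ℕ.≤-pred j<1+n))
      where
      prefix : ∀ j → j < n → s j ≡ t j
      prefix = partialSumᵘ-injective n s t (≈-trans (≈-sym (partialSumᵘ-suc-≈ s n))
        (≈-trans (≈-weaken (ℕ.n≤1+n n) sₙ₊₁≈tₙ₊₁) (partialSumᵘ-suc-≈ t n)))
      cancel-prefix : ∀ X p a b → (X + p * a) - (X + p * b) ≃ p * (a - b)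
      cancel-prefix = solve 4 (λ X p a b → (X :+ p :* a) :- (X :+ p :* b) := p :* (a :- b)) ≃-refl
      last : s n ≡ t n
      last = last-digit-≡ n (s n) (t n) (NormLe-cong (cancel-prefix (partialSumᵘ t n) (powᵘ n) _ _)
        (subst (λ S → NormLe ((S + powᵘ n * digitᵘ (s n)) - partialSumᵘ t (suc n)) (suc n))
          (partialSumᵘ-cong s t n prefix) (NormLe-diff sₙ₊₁≈tₙ₊₁)))
      pick : j < n ⊎ j ≡ n → s j ≡ t j
      pick (inj₁ j<n) = prefix j j<n
      pick (inj₂ refl) = last

    expansion : (u : ℚ.ℚ) → InD m u → ℕ → Fin m
    expansion (ℚ.mkℚ a b _) b⊥m = Digits.digits b b⊥m a

    ≈-partialSumᵘ-expansion : ∀ u (u∈D : InD m u) n → ℚ.toℚᵘ u ≈[ n ] partialSumᵘ (expansion u u∈D) n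
    ≈-partialSumᵘ-expansion (ℚ.mkℚ a b _) b⊥m = Digits.≈-partialSumᵘ-digits b b⊥m a

    expansion-agree : ∀ {n} u v (u∈D : InD m u) (v∈D : InD m v) → ℚ.toℚᵘ u ≈[ n ] ℚ.toℚᵘ v →
                      ∀ j → j < n → expansion u u∈D j ≡ expansion v v∈D j
    expansion-agree {n} u v u∈D v∈D u≈v = partialSumᵘ-injective n _ _
      (≈-trans (≈-sym (≈-partialSumᵘ-expansion u u∈D n)) (≈-trans u≈v (≈-partialSumᵘ-expansion v v∈D n)))

    module _ (x : CauchySeq m) where

      private
        xᵘ : ℕ → ℚᵘ
        xᵘ q = ℚ.toℚᵘ (seq x q)

      DistLe-partialSum⇒≈ : ∀ {n} s p q → DistLe m (partialSum m s p) (seq x q) n → partialSumᵘ s p ≈[ n ] xᵘ q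
      DistLe-partialSum⇒≈ s p q = DistLe⇒≈ (toℚᵘ-partialSum s p) ≃-refl
        (CoprimeDen-partialSumᵘ s p) (InD⇒CoprimeDen (seq x q) (inD x q))

      modulus : ℕ → ℕ
      modulus n = proj₁ (cauchy x n)

      cauchy-≈ : ∀ {n p q} → modulus n ≤ p → modulus n ≤ q → xᵘ p ≈[ n ] xᵘ q
      cauchy-≈ {n} {p} {q} N≤p N≤q = DistLe⇒≈ {seq x p} {seq x q} ≃-refl ≃-refl
        (InD⇒CoprimeDen (seq x p) (inD x p)) (InD⇒CoprimeDen (seq x q) (inD x q))
        (proj₂ (cauchy x n) p q N≤p N≤q)

      limitDigits : ℕ → Fin m
      limitDigits j = expansion (seq x (modulus (suc j))) (inD x _) j

      stableFrom : ℕ → ℕ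
      stableFrom zero    = 0
      stableFrom (suc n) = stableFrom n ⊔ modulus (suc n)

      modulus≤stableFrom : ∀ {j n} → j < n → modulus (suc j) ≤ stableFrom n
      modulus≤stableFrom {j} {suc n} j<1+n with ℕ.m≤n⇒m<n∨m≡n (ℕ.≤-pred j<1+n)
      ... | inj₁ j<n  = ℕ.m≤n⇒m≤n⊔o (modulus (suc n)) (modulus≤stableFrom j<n)
      ... | inj₂ refl = ℕ.m≤n⊔m (stableFrom n) (modulus (suc n))

      limitDigits-agree : ∀ {n q} → stableFrom n ≤ q →
                          ∀ j → j < n → limitDigits j ≡ expansion (seq x q) (inD x q) j
      limitDigits-agree {n} {q} stable≤q j j<n = expansion-agree _ (seq x q) (inD x _) (inD x q)
        (cauchy-≈ ℕ.≤-refl (ℕ.≤-trans (modulus≤stableFrom j<n) stable≤q)) j (ℕ.n<1+n j)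

      limitDigits-converge : SeriesConvergesTo m limitDigits x
      limitDigits-converge n = n , λ p n≤p → stableFrom n , λ q stable≤q →
        ≈⇒DistLe (toℚᵘ-partialSum limitDigits p) ≃-refl (≈-trans (partialSumᵘ-≈ limitDigits n≤p)
          (subst (_≈[ n ] xᵘ q) (sym (partialSumᵘ-cong _ _ n (limitDigits-agree stable≤q)))
            (≈-sym (≈-partialSumᵘ-expansion (seq x q) (inD x q) n))))

      limits-agree : ∀ {s t} → SeriesConvergesTo m s x → SeriesConvergesTo m t x →
                     ∀ n → partialSumᵘ s n ≈[ n ] partialSumᵘ t n
      limits-agree {s} {t} s→x t→x n =
        ≈-trans (≈-sym (partialSumᵘ-≈ s n≤p)) (≈-trans (DistLe-partialSum⇒≈ s p Q sₚ≈x)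
          (≈-trans (≈-sym (DistLe-partialSum⇒≈ t p Q tₚ≈x)) (partialSumᵘ-≈ t n≤p)))
        where
        Nₛ Nₜ p : ℕ
        Nₛ = proj₁ (s→x n)
        Nₜ = proj₁ (t→x n)
        p  = n ⊔ (Nₛ ⊔ Nₜ)
        n≤p : n ≤ p
        n≤p = ℕ.m≤m⊔n n _
        Nₛ≤p : Nₛ ≤ p
        Nₛ≤p = ℕ.≤-trans (ℕ.m≤m⊔n Nₛ Nₜ) (ℕ.m≤n⊔m n _)
        Nₜ≤p : Nₜ ≤ p
        Nₜ≤p = ℕ.≤-trans (ℕ.m≤n⊔m Nₛ Nₜ) (ℕ.m≤n⊔m n _)
        Qₛ Qₜ Q : ℕ
        Qₛ = proj₁ (proj₂ (s→x n) p Nₛ≤p)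
        Qₜ = proj₁ (proj₂ (t→x n) p Nₜ≤p)
        Q = Qₛ ⊔ Qₜ
        sₚ≈x : DistLe m (partialSum m s p) (seq x Q) n
        sₚ≈x = proj₂ (proj₂ (s→x n) p Nₛ≤p) Q (ℕ.m≤m⊔n Qₛ Qₜ)
        tₚ≈x : DistLe m (partialSum m t p) (seq x Q) n
        tₚ≈x = proj₂ (proj₂ (t→x n) p Nₜ≤p) Q (ℕ.m≤n⊔m Qₛ Qₜ)

      limit-digits-unique : ∀ {s t} → SeriesConvergesTo m s x → SeriesConvergesTo m t x → ∀ k → s k ≡ t k
      limit-digits-unique s→x t→x k =
        partialSumᵘ-injective (suc k) _ _ (limits-agree s→x t→x (suc k)) k (ℕ.n<1+n k)

proposition9 : (m : ℕ) → 2 ≤ m → (x : CauchySeq m) →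
    Σ (ℕ → Fin m) (λ s → SeriesConvergesTo m s x ×
      ((t : ℕ → Fin m) → SeriesConvergesTo m t x → ∀ k → t k ≡ s k))
proposition9 m 2≤m x =
  limitDigits m x , limitDigits-converge m x ,
  λ t t→x → limit-digits-unique m x t→x (limitDigits-converge m x)
  where
  instance
    m≢0 : NonZero m
    m≢0 = ℕ.>-nonZero (ℕ.<-≤-trans (ℕ.s≤s ℕ.z≤n) 2≤m)
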